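{- Let $n\ge1$ and let $E$ be a bijection of $\{0,1\}^n$. If $(\psi_1,i_1),\dots,(\psi_m,i_m)$ is an in situ program of $E$, then the reversed sequence $(\psi_m,i_m),\dots,(\psi_1,i_1)$ is an in situ program of $E^{ -1}$.
   Context: For a set $S$ and $n\ge1$, an in situ program of a mapping $E:S^n\to S^n$ is a finite sequence $(\psi_1,i_1),\dots,(\psi_m,i_m)$ with $\psi_k:S^n\to S$ and $i_k\in\{1,\dots,n\}$ such that for every $X\in S^n$, setting $X_0=X$ and letting $X_k$ be the vector equal to $X_{k-1}$ except that its $i_k$-th component is replaced by $\psi_k(X_{k-1})$, one has $X_m=E(X)$. -}

module Defs where

open import Data.Bool using (Bool)
open import Data.Nat using (ℕ)
open import Data.Fin using (Fin)
open import Data.Vec using (Vec; _[_]≔_)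
open import Data.List using (List; []; _∷_)
open import Data.Product using (_×_; _,_)
open import Relation.Binary.PropositionalEquality using (_≡_)

Instr : Set → ℕ → Set
Instr S n = (Vec S n → S) × Fin n

step : {S : Set} {n : ℕ} → Instr S n → Vec S n → Vec S n
step (ψ , i) X = X [ i ]≔ ψ X

run : {S : Set} {n : ℕ} → List (Instr S n) → Vec S n → Vec S n
run [] X = X
run (c ∷ cs) X = run cs (step c X)

IsInSituProgram : {S : Set} {n : ℕ} → List (Instr S n) → (Vec S n → Vec S n) → Set
IsInSituProgram P E = ∀ X → run P X ≡ E X

-- Over Bool an injective assignment X ↦ X [ i ]≔ ψ X must be an involution: either it fixes X,
-- or it flips X i, and then ψ of the new vector cannot equal ψ X (injectivity again), so it is
-- the other Boolean value, the original X i. Peeling instructions off the front of an injective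
-- program keeps it injective, since a program is its tail precomposed with an involution; hence
-- undoing the instructions in reverse order inverts the program, i.e. computes E⁻¹.
module Submission where

open import Defs
open import Data.Bool using (Bool; not; _≟_)
open import Data.Bool.Properties using (¬-not; not-involutive)
open import Data.Nat using (ℕ; _≥_)
open import Data.Vec using (Vec; lookup; _[_]≔_)
open import Data.Vec.Properties using ([]≔-idempotent; []≔-lookup; lookup∘update)
open import Data.List using (List; []; _∷_; reverse; _∷ʳ_)
open import Data.List.Properties using (unfold-reverse)
open import Data.Product using (proj₁; proj₂)
open import Function.Base using (_∘_)
open import Function.Bundles using (_↔_; Inverse; Injection)
open import Function.Definitions using (Injective)
open import Function.Properties.Inverse using (↔⇒↣)
open import Relation.Nullary using (yes; no)
open import Relation.Binary.PropositionalEquality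
  using (_≡_; _≢_; refl; sym; trans; cong; module ≡-Reasoning)

private
  variable
    S : Set
    n : ℕ

run-∷ʳ : (P : List (Instr S n)) (c : Instr S n) (X : Vec S n) →
         run (P ∷ʳ c) X ≡ step c (run P X)
run-∷ʳ []      c X = refl
run-∷ʳ (d ∷ P) c X = run-∷ʳ P c (step d X)

module _ {c : Instr Bool n} (inj : Injective _≡_ _≡_ (step c)) where

  private
    ψ = proj₁ c
    i = proj₂ c

  step-restores : ∀ X → ψ (X [ i ]≔ ψ X) ≡ lookup X i
  step-restores X with ψ X ≟ lookup X i
  ... | yes ψX≡Xi = trans (cong ψ fixes) ψX≡Xi
    where
    fixes : X [ i ]≔ ψ X ≡ X
    fixes = trans (cong (X [ i ]≔_) ψX≡Xi) ([]≔-lookup X i)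
  ... | no ψX≢Xi = begin
      ψ Y                    ≡⟨ ¬-not ψY≢ψX ⟩
      not (ψ X)              ≡⟨ cong not (¬-not ψX≢Xi) ⟩
      not (not (lookup X i)) ≡⟨ not-involutive (lookup X i) ⟩
      lookup X i             ∎
    where
    open ≡-Reasoning
    Y = X [ i ]≔ ψ X
    ψY≢ψX : ψ Y ≢ ψ X
    ψY≢ψX ψY≡ψX = ψX≢Xi (begin
      ψ X        ≡⟨ lookup∘update i X (ψ X) ⟨
      lookup Y i ≡⟨ cong (λ Z → lookup Z i) (inj stepY≡stepX) ⟩
      lookup X i ∎)
      where
      stepY≡stepX : Y [ i ]≔ ψ Y ≡ X [ i ]≔ ψ X
      stepY≡stepX = trans (cong (Y [ i ]≔_) ψY≡ψX) ([]≔-idempotent X i)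

  step-involutive : ∀ X → step c (step c X) ≡ X
  step-involutive X = begin
    (X [ i ]≔ ψ X) [ i ]≔ ψ (X [ i ]≔ ψ X) ≡⟨ []≔-idempotent X i ⟩
    X [ i ]≔ ψ (X [ i ]≔ ψ X)              ≡⟨ cong (X [ i ]≔_) (step-restores X) ⟩
    X [ i ]≔ lookup X i                    ≡⟨ []≔-lookup X i ⟩
    X                                      ∎
    where open ≡-Reasoning

module _ (c : Instr Bool n) (P : List (Instr Bool n)) (inj : Injective _≡_ _≡_ (run (c ∷ P))) where

  head-injective : Injective _≡_ _≡_ (step c)
  head-injective = inj ∘ cong (run P)

  tail-injective : Injective _≡_ _≡_ (run P)
  tail-injective {X} {Y} PX≡PY =
    head-injective (inj (trans (undo X) (trans PX≡PY (sym (undo Y)))))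
    where
    undo : ∀ Z → run (c ∷ P) (step c Z) ≡ run P Z
    undo Z = cong (run P) (step-involutive head-injective Z)

run-reverse-inverseˡ : (P : List (Instr Bool n)) → Injective _≡_ _≡_ (run P) →
                       ∀ X → run (reverse P) (run P X) ≡ X
run-reverse-inverseˡ []      inj X = refl
run-reverse-inverseˡ (c ∷ P) inj X = begin
  run (reverse (c ∷ P)) (run P (step c X))    ≡⟨ cong (λ Q → run Q (run P (step c X))) (unfold-reverse c P) ⟩
  run (reverse P ∷ʳ c) (run P (step c X))     ≡⟨ run-∷ʳ (reverse P) c _ ⟩
  step c (run (reverse P) (run P (step c X))) ≡⟨ cong (step c) (run-reverse-inverseˡ P (tail-injective c P inj) (step c X)) ⟩
  step c (step c X)                           ≡⟨ step-involutive (head-injective c P inj) X ⟩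
  X                                           ∎
  where open ≡-Reasoning

corollary4 : (n : ℕ) → n ≥ 1 → (E : Vec Bool n ↔ Vec Bool n) →
    (P : List (Instr Bool n)) →
    IsInSituProgram P (Inverse.to E) →
    IsInSituProgram (reverse P) (Inverse.from E)
corollary4 n _ E P prog Y = begin
  run (reverse P) Y                ≡⟨ cong (run (reverse P)) (trans (prog (from Y)) (strictlyInverseˡ Y)) ⟨
  run (reverse P) (run P (from Y)) ≡⟨ run-reverse-inverseˡ P P-injective (from Y) ⟩
  from Y                           ∎
  where
  open ≡-Reasoning
  open Inverse E
  P-injective : Injective _≡_ _≡_ (run P)
  P-injective {X} {Z} PX≡PZ =
    Injection.injective (↔⇒↣ E) (trans (sym (prog X)) (trans PX≡PZ (prog Z)))
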